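{- Let $k$ be a positive integer and suppose there exist positive integers $u$ and $v$ such that $s_2(u)+s_2(v)=s_2(u^2)+s_2(uv)+s_2(v^2)=k$. Then for all sufficiently large integers $i$, the integer $n$ whose binary representation is the concatenation of the binary representation of $u$, a block of $i$ zeros, and the binary representation of $v$ (i.e. $n=u\cdot 2^{i+L}+v$, where $L$ is the number of binary digits of $v$) satisfies $s_2(n^2)=s_2(n)=k$.
   Context: $s_2(m)$ denotes the sum of the binary digits of the nonnegative integer $m$. -}

module Defs where

open import Data.Nat using (ℕ; zero; suc; _+_; _*_; _^_; _/_; _%_)

-- Sum of binary digits, computed with fuel; fuel m ≥ n suffices since n/2 < n for n > 0.
s₂-fuel : ℕ → ℕ → ℕ
s₂-fuel zero    n = 0
s₂-fuel (suc f) n = n % 2 + s₂-fuel f (n / 2)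

s₂ : ℕ → ℕ
s₂ m = s₂-fuel m m

-- Number of binary digits (bit length); bitLength 0 = 0.
bitLength-fuel : ℕ → ℕ → ℕ
bitLength-fuel zero    n       = 0
bitLength-fuel (suc f) zero    = 0
bitLength-fuel (suc f) (suc n) = suc (bitLength-fuel f (suc n / 2))

bitLength : ℕ → ℕ
bitLength m = bitLength-fuel m m

concatBin : ℕ → ℕ → ℕ → ℕ
concatBin u i v = u * 2 ^ (i + bitLength v) + v

module Submission where

-- Binary digit sums are additive under "concatenation": if b < 2^m then
-- the binary expansion of a * 2^m + b is that of a followed by that of b, so
--   s₂ (a * 2^m + b) ≡ s₂ a + s₂ b.                                (s₂-concat)
-- With P = 2^m and m = i + bitLength v, the number n = u * P + v and its square
--   n² = u² * 2^(2m) + (uv * 2^(m+1) + v²)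
-- are both such concatenations as soon as m is large compared with uv and v²
-- (the "carries" cannot overlap).  Hence s₂ n = s₂ u + s₂ v and
-- s₂ (n²) = s₂ (u²) + s₂ (uv) + s₂ (v²), and both equal k by hypothesis.

open import Defs
open import Data.Nat using (ℕ; zero; suc; _+_; _*_; _^_; _/_; _%_; _≤_; _<_; _≥_; z≤n; s≤s; NonZero)
open import Data.Nat.Properties
open import Data.Nat.DivMod
open import Data.Product using (Σ; _×_; _,_)
open import Relation.Binary.PropositionalEquality
  using (_≡_; refl; sym; trans; cong; cong₂; module ≡-Reasoning)
open import Data.Nat.Solver using (module +-*-Solver)
open +-*-Solver

s₂-fuel-zero : ∀ f → s₂-fuel f 0 ≡ 0
s₂-fuel-zero zero    = refl
s₂-fuel-zero (suc f) = s₂-fuel-zero f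

half-≤ : ∀ {n f} → n ≤ suc f → n / 2 ≤ f
half-≤ {zero}  _   = z≤n
half-≤ {suc n} n≤f = ≤-pred (≤-trans (m/n<m (suc n) 2 (s≤s (s≤s z≤n))) n≤f)

s₂-fuel-irrelevant : ∀ f g n → n ≤ f → n ≤ g → s₂-fuel f n ≡ s₂-fuel g n
s₂-fuel-irrelevant zero    g       .0 z≤n _   = sym (s₂-fuel-zero g)
s₂-fuel-irrelevant (suc f) zero    .0 _   z≤n = s₂-fuel-zero (suc f)
s₂-fuel-irrelevant (suc f) (suc g) n  n≤f n≤g =
  cong (n % 2 +_) (s₂-fuel-irrelevant f g (n / 2) (half-≤ n≤f) (half-≤ n≤g))

s₂-unfold : ∀ n → s₂ n ≡ n % 2 + s₂ (n / 2)
s₂-unfold zero    = refl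
s₂-unfold (suc n) =
  cong (suc n % 2 +_) (s₂-fuel-irrelevant n (suc n / 2) (suc n / 2) (half-≤ ≤-refl) ≤-refl)

s₂-append-digit : ∀ b x → b ≤ 1 → s₂ (b + x * 2) ≡ b + s₂ x
s₂-append-digit b x b≤1 =
  trans (s₂-unfold (b + x * 2)) (cong₂ _+_ last-digit (cong s₂ rest))
  where
  b%2≡b : b % 2 ≡ b
  b%2≡b = m<n⇒m%n≡m (s≤s b≤1)
  last-digit : (b + x * 2) % 2 ≡ b
  last-digit = trans ([m+kn]%n≡m%n b x 2) b%2≡b
  no-carry : b % 2 + (x * 2) % 2 < 2
  no-carry = ≤-<-trans
    (≤-reflexive (trans (cong₂ _+_ b%2≡b (m*n%n≡0 x 2)) (+-identityʳ b))) (s≤s b≤1)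
  rest : (b + x * 2) / 2 ≡ x
  rest = trans (+-distrib-/ b (x * 2) no-carry)
               (cong₂ _+_ (m<n⇒m/n≡0 (s≤s b≤1)) (m*n/n≡m x 2))

s₂-concat : ∀ m a b → b < 2 ^ m → s₂ (a * 2 ^ m + b) ≡ s₂ a + s₂ b
s₂-concat zero a zero _ rewrite *-identityʳ a | +-identityʳ a | +-identityʳ (s₂ a) = refl
s₂-concat zero a (suc b) (s≤s ())
s₂-concat (suc m) a b b<2^m+1 = begin
    s₂ (a * 2 ^ suc m + b)
  ≡⟨ cong s₂ split-last-digit ⟩
    s₂ (b % 2 + (a * 2 ^ m + b / 2) * 2)
  ≡⟨ s₂-append-digit (b % 2) (a * 2 ^ m + b / 2) (digit≤1 b) ⟩
    b % 2 + s₂ (a * 2 ^ m + b / 2)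
  ≡⟨ cong (b % 2 +_) (s₂-concat m a (b / 2) b/2<2^m) ⟩
    b % 2 + (s₂ a + s₂ (b / 2))
  ≡⟨ solve 3 (λ r s t → r :+ (s :+ t) := s :+ (r :+ t)) refl (b % 2) (s₂ a) (s₂ (b / 2)) ⟩
    s₂ a + (b % 2 + s₂ (b / 2))
  ≡⟨ cong (s₂ a +_) (sym (s₂-unfold b)) ⟩
    s₂ a + s₂ b ∎
  where
  open ≡-Reasoning
  digit≤1 : ∀ n → n % 2 ≤ 1
  digit≤1 n = ≤-pred (m%n<n n 2)
  split-last-digit : a * 2 ^ suc m + b ≡ b % 2 + (a * 2 ^ m + b / 2) * 2
  split-last-digit = trans (cong (a * 2 ^ suc m +_) (m≡m%n+[m/n]*n b 2))
    (solve 4 (λ a P r q → a :* (con 2 :* P) :+ (r :+ q :* con 2)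
                        := r :+ (a :* P :+ q) :* con 2) refl a (2 ^ m) (b % 2) (b / 2))
  b/2<2^m : b / 2 < 2 ^ m
  b/2<2^m = m<n*o⇒m/o<n (<-≤-trans b<2^m+1 (≤-reflexive (*-comm 2 (2 ^ m))))

<2^ : ∀ {n m} → n ≤ m → n < 2 ^ m
<2^ {n} {m} n≤m = <-≤-trans (n<2^n n) (^-monoʳ-≤ 2 n≤m)
  where
  n<2^n : ∀ n → n < 2 ^ n
  n<2^n zero    = s≤s z≤n
  n<2^n (suc n) = ≤-trans (≤-reflexive (+-comm 1 (suc n)))
    (+-mono-≤ (n<2^n n) (≤-trans (m^n>0 2 n) (m≤m+n (2 ^ n) 0)))

concat-< : ∀ a b p q → a < 2 ^ p → b < 2 ^ q → a * 2 ^ q + b < 2 ^ (p + q)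
concat-< a b p q a<2^p b<2^q = begin-strict
    a * 2 ^ q + b     <⟨ +-monoʳ-< (a * 2 ^ q) b<2^q ⟩
    a * 2 ^ q + 2 ^ q ≡⟨ +-comm (a * 2 ^ q) (2 ^ q) ⟩
    suc a * 2 ^ q     ≤⟨ *-monoˡ-≤ (2 ^ q) a<2^p ⟩
    2 ^ p * 2 ^ q     ≡⟨ sym (^-distribˡ-+-* 2 p q) ⟩
    2 ^ (p + q)       ∎
  where open ≤-Reasoning

-- The square of u * P + v, arranged as a binary concatenation.
square-expansion : ∀ u v P →
  (u * P + v) * (u * P + v) ≡ u * u * (P * P) + (u * v * (2 * P) + v * v)
square-expansion = solve 3 (λ u v P → (u :* P :+ v) :* (u :* P :+ v)
  := u :* u :* (P :* P) :+ (u :* v :* (con 2 :* P) :+ v :* v)) refl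

-- The two digit-sum identities behind the theorem, for a shift m exceeding
-- uv + v²: then v, v² and uv * 2^(m+1) + v² fit below the blocks above them.
module LongShift (u v m : ℕ) .{{_ : NonZero v}} (large : suc (u * v + v * v) ≤ m) where
  open ≡-Reasoning

  v²≤m : v * v ≤ m
  v²≤m = ≤-trans (m≤n+m (v * v) (u * v)) (≤-trans (n≤1+n _) large)

  v²<2^m+1 : v * v < 2 ^ suc m
  v²<2^m+1 = <2^ (m≤n⇒m≤1+n v²≤m)

  low-blocks< : u * v * 2 ^ suc m + v * v < 2 ^ (m + m)
  low-blocks< = <-≤-trans (concat-< (u * v) (v * v) (u * v) (suc m) (<2^ ≤-refl) v²<2^m+1)
    (^-monoʳ-≤ 2 (≤-trans (≤-reflexive (+-suc (u * v) m)) (+-monoˡ-≤ m uv<m)))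
    where
    uv<m : suc (u * v) ≤ m
    uv<m = ≤-trans (s≤s (m≤m+n (u * v) (v * v))) large

  s₂-shifted : s₂ (u * 2 ^ m + v) ≡ s₂ u + s₂ v
  s₂-shifted = s₂-concat m u v (≤-<-trans (m≤m*n v v) (<2^ v²≤m))

  s₂-shifted-square : s₂ ((u * 2 ^ m + v) * (u * 2 ^ m + v))
                    ≡ s₂ (u * u) + s₂ (u * v) + s₂ (v * v)
  s₂-shifted-square = begin
      s₂ ((u * 2 ^ m + v) * (u * 2 ^ m + v))
    ≡⟨ cong s₂ (square-expansion u v (2 ^ m)) ⟩
      s₂ (u * u * (2 ^ m * 2 ^ m) + low)
    ≡⟨ cong (λ Q → s₂ (u * u * Q + low)) (sym (^-distribˡ-+-* 2 m m)) ⟩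
      s₂ (u * u * 2 ^ (m + m) + low)
    ≡⟨ s₂-concat (m + m) (u * u) low low-blocks< ⟩
      s₂ (u * u) + s₂ low
    ≡⟨ cong (s₂ (u * u) +_) (s₂-concat (suc m) (u * v) (v * v) v²<2^m+1) ⟩
      s₂ (u * u) + (s₂ (u * v) + s₂ (v * v))
    ≡⟨ sym (+-assoc (s₂ (u * u)) (s₂ (u * v)) (s₂ (v * v))) ⟩
      s₂ (u * u) + s₂ (u * v) + s₂ (v * v) ∎
    where
    low : ℕ
    low = u * v * 2 ^ suc m + v * v

proposition4p1 : (k u v : ℕ) → .{{NonZero k}} → .{{NonZero u}} → .{{NonZero v}} →
    s₂ u + s₂ v ≡ k → s₂ (u * u) + s₂ (u * v) + s₂ (v * v) ≡ k →
    Σ ℕ (λ i₀ → (i : ℕ) → i ≥ i₀ →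
    (s₂ (concatBin u i v * concatBin u i v) ≡ k) × (s₂ (concatBin u i v) ≡ k))
proposition4p1 k u v s₂-linear s₂-square = suc (u * v + v * v) , digit-sums
  where
  digit-sums : (i : ℕ) → i ≥ suc (u * v + v * v) →
    (s₂ (concatBin u i v * concatBin u i v) ≡ k) × (s₂ (concatBin u i v) ≡ k)
  digit-sums i i≥ =
      trans s₂-shifted-square s₂-square
    , trans s₂-shifted s₂-linear
    where open LongShift u v (i + bitLength v) (≤-trans i≥ (m≤m+n i (bitLength v)))
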